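{- For each integer $n \ge 0$, let $a_1(n)$ denote the number of odd coefficients of the polynomial $(1+x+x^2)^n \in \mathbb{Z}[x]$ (equivalently, the value at $x=1$ of $(1+x+x^2)^n$ after reducing each coefficient modulo $2$ to $0$ or $1$). For $k \ge 0$ let $b_1(k) := a_1(2^k-1)$, and let $f_1(t) := \sum_{k=0}^{\infty} b_1(k)\, t^k$. Then $$ f_1(t) = \frac{1+2t}{(1+t)(1-2t)}. $$
   Context: Coefficients are reduced modulo $2$ only (not the exponents of $x$); $a_1(n)$ counts the monomials surviving this reduction. -}

module Defs where

open import Data.Nat using (ℕ; zero; suc; _+_; _*_; _∸_; _^_; _%_)
open import Data.List using (List; []; _∷_; map)
open import Data.Nat.ListAction using (sum)
open import Data.Integer as ℤ using (ℤ; +_; -[1+_])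

-- Polynomials in ℤ[x] with (here nonnegative) coefficients, as coefficient lists
-- (constant term first). (1+x+x^2)^n has natural-number coefficients.
Poly : Set
Poly = List ℕ

addP : Poly → Poly → Poly
addP [] q = q
addP p [] = p
addP (a ∷ p) (b ∷ q) = (a + b) ∷ addP p q

scaleP : ℕ → Poly → Poly
scaleP c = map (c *_)

mulP : Poly → Poly → Poly
mulP [] q = []
mulP (a ∷ p) q = addP (scaleP a q) (0 ∷ mulP p q)

powP : Poly → ℕ → Poly
powP p zero = 1 ∷ []
powP p (suc n) = mulP p (powP p n)

trinom : Poly
trinom = 1 ∷ 1 ∷ 1 ∷ []

a₁ : ℕ → ℕ
a₁ n = sum (map (λ c → c % 2) (powP trinom n))

b₁ : ℕ → ℕ
b₁ k = a₁ (2 ^ k ∸ 1)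

Series : Set
Series = ℕ → ℤ

-- Cauchy product: (f ⋆ g) n = Σ_{i=0}^{n} f i * g (n - i)
convAux : Series → Series → ℕ → ℕ → ℤ
convAux f g n zero = f 0 ℤ.* g n
convAux f g n (suc i) = f (suc i) ℤ.* g (n ∸ suc i) ℤ.+ convAux f g n i

_⋆_ : Series → Series → Series
(f ⋆ g) n = convAux f g n n

fromList : List ℤ → Series
fromList [] n = + 0
fromList (c ∷ cs) zero = c
fromList (c ∷ cs) (suc n) = fromList cs n

f₁ : Series
f₁ k = + b₁ k

onePlusT : Series
onePlusT = fromList (+ 1 ∷ + 1 ∷ [])

oneMinus2T : Series
oneMinus2T = fromList (+ 1 ∷ -[1+ 1 ] ∷ [])

onePlus2T : Series
onePlus2T = fromList (+ 1 ∷ + 2 ∷ [])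

-- Modulo 2 the coefficients of (1 + x + x²)^(2^k − 1) form a polynomial Pₖ over 𝔽₂, and
-- 2^(k+1) − 1 = 2(2^k − 1) + 1 together with the Frobenius identity (1 + x + x²)² = 1 + x² + x⁴
-- give Pₖ₊₁(x) = (1 + x + x²) Pₖ(x²). Splitting into even and odd parts, Pₖ₊₁ has even part
-- (1 + x) Pₖ and odd part Pₖ, while (1 + x) Pₖ₊₁ has even part Pₖ and odd part x Pₖ. Counting
-- nonzero coefficients, b₁(k+1) = d₁(k) + b₁(k) and d₁(k+1) = 2 b₁(k), where d₁(k) is the weight
-- of (1 + x) Pₖ. Hence b₁(k+2) = b₁(k+1) + 2 b₁(k) with b₁(0) = 1 and b₁(1) = 3, which says
-- exactly that f₁(t)(1 − t − 2t²) = 1 + 2t.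

module Submission where

open import Defs
open import Relation.Binary.PropositionalEquality using (_≡_)
open import Data.Nat using (ℕ)

open import Function using (_∘_)
open import Relation.Binary.PropositionalEquality
  using (refl; sym; trans; cong; cong₂; _≗_; _→-setoid_; module ≡-Reasoning)
open import Data.Nat
  using (zero; suc; _+_; _*_; _∸_; _^_; _%_; _≤_; _<_; _⊔_; z≤n; s≤s; parity)
open import Data.Nat.Properties
  using (+-assoc; +-identityʳ; *-suc; *-zeroʳ; ≤-refl; ≤-trans; n≤1+n; n<1+n; ⊔-lub; m^n>0;
         +-monoˡ-≤; +-monoʳ-≤; m+n∸n≡m; n∸n≡0; m+n≤o⇒m≤o∸n; +-commutativeSemigroup; module ≤-Reasoning)
open import Algebra.Properties.CommutativeSemigroup +-commutativeSemigroup using (interchange)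
open import Data.List using ([]; _∷_; map; length)
open import Data.List.Properties using (length-map)
open import Data.Nat.ListAction using (sum)
open import Data.Parity.Base using (Parity; 0ℙ; 1ℙ)
open import Data.Integer using (-[1+_])

open import Data.Integer.Tactic.RingSolver using (solve-∀)
import Relation.Binary.Reasoning.Setoid as SetoidReasoning

module ℙ where
  open import Data.Parity.Base public
  open import Data.Parity.Properties public

module ℤ where
  open import Data.Integer public
  open import Data.Integer.Properties public

-- Coefficients of integer polynomials

coeff : Poly → ℕ → ℕ
coeff [] _ = 0
coeff (a ∷ p) zero = a
coeff (a ∷ p) (suc i) = coeff p i

coeff-addP : ∀ p q i → coeff (addP p q) i ≡ coeff p i + coeff q i
coeff-addP [] q i = refl
coeff-addP (a ∷ p) [] i = sym (+-identityʳ _)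
coeff-addP (a ∷ p) (b ∷ q) zero = refl
coeff-addP (a ∷ p) (b ∷ q) (suc i) = coeff-addP p q i

coeff-scaleP : ∀ a p i → coeff (scaleP a p) i ≡ a * coeff p i
coeff-scaleP a [] i = sym (*-zeroʳ a)
coeff-scaleP a (b ∷ p) zero = refl
coeff-scaleP a (b ∷ p) (suc i) = coeff-scaleP a p i

coeff-beyond-length : ∀ p {i} → length p ≤ i → coeff p i ≡ 0
coeff-beyond-length [] _ = refl
coeff-beyond-length (a ∷ p) (s≤s le) = coeff-beyond-length p le

length-addP : ∀ p q → length (addP p q) ≡ length p ⊔ length q
length-addP [] q = refl
length-addP (a ∷ p) [] = refl
length-addP (a ∷ p) (b ∷ q) = cong suc (length-addP p q)

length-mulP : ∀ p q {n} → length q ≤ suc n → length (mulP p q) ≤ length p + n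
length-mulP [] q _ = z≤n
length-mulP (a ∷ p) q {n} lq = begin
  length (addP (scaleP a q) (0 ∷ mulP p q))     ≡⟨ length-addP (scaleP a q) (0 ∷ mulP p q) ⟩
  length (scaleP a q) ⊔ suc (length (mulP p q)) ≤⟨ ⊔-lub scaled (s≤s (length-mulP p q lq)) ⟩
  suc (length p + n)                            ∎
  where
    open ≤-Reasoning
    scaled : length (scaleP a q) ≤ suc (length p + n)
    scaled rewrite length-map (a *_) q = ≤-trans lq (s≤s (+-monoˡ-≤ n z≤n))

length-powP : ∀ p {d} n → length p ≤ suc d → length (powP p n) ≤ suc (d * n)
length-powP p zero _ = s≤s z≤n
length-powP p {d} (suc n) lp rewrite *-suc d n =
  ≤-trans (length-mulP p (powP p n) (length-powP p n lp)) (+-monoˡ-≤ (d * n) lp)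

-- Power series over 𝔽₂

Seq₂ : Set
Seq₂ = ℕ → Parity

module ≗-Reasoning = SetoidReasoning (ℕ →-setoid Parity)

infixl 6 _⊕_
infixr 9 x·_ [1+x]·_ [1+x+x²]·_ _·ˢ_

0ˢ : Seq₂
0ˢ _ = 0ℙ

_⊕_ : Seq₂ → Seq₂ → Seq₂
(f ⊕ g) i = f i ℙ.+ g i

_·ˢ_ : Parity → Seq₂ → Seq₂
(c ·ˢ f) i = c ℙ.* f i

x·_ : Seq₂ → Seq₂
(x· f) zero = 0ℙ
(x· f) (suc i) = f i

[1+x]·_ : Seq₂ → Seq₂
[1+x]· f = f ⊕ x· f

[1+x+x²]·_ : Seq₂ → Seq₂
[1+x+x²]· f = f ⊕ x· [1+x]· f

-- interleave f g = f(x²) + x g(x²)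
interleave : Seq₂ → Seq₂ → Seq₂
interleave f g zero = f zero
interleave f g (suc i) = interleave g (f ∘ suc) i

spread : Seq₂ → Seq₂
spread f = interleave f 0ˢ

⊕-cong : ∀ {f f′ g g′} → f ≗ f′ → g ≗ g′ → f ⊕ g ≗ f′ ⊕ g′
⊕-cong f≗f′ g≗g′ i = cong₂ ℙ._+_ (f≗f′ i) (g≗g′ i)

⊕-congˡ : ∀ f {g g′} → g ≗ g′ → f ⊕ g ≗ f ⊕ g′
⊕-congˡ f g≗g′ i = cong (f i ℙ.+_) (g≗g′ i)

x·-cong : ∀ {f g} → f ≗ g → x· f ≗ x· g
x·-cong f≗g zero = refl
x·-cong f≗g (suc i) = f≗g i

[1+x]·-cong : ∀ {f g} → f ≗ g → [1+x]· f ≗ [1+x]· g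
[1+x]·-cong f≗g = ⊕-cong f≗g (x·-cong f≗g)

[1+x+x²]·-cong : ∀ {f g} → f ≗ g → [1+x+x²]· f ≗ [1+x+x²]· g
[1+x+x²]·-cong f≗g = ⊕-cong f≗g (x·-cong ([1+x]·-cong f≗g))

interleave-cong : ∀ {f f′ g g′} → f ≗ f′ → g ≗ g′ → interleave f g ≗ interleave f′ g′
interleave-cong f≗f′ g≗g′ zero = f≗f′ zero
interleave-cong f≗f′ g≗g′ (suc i) = interleave-cong g≗g′ (f≗f′ ∘ suc) i

x·-0ˢ : x· 0ˢ ≗ 0ˢ
x·-0ˢ zero = refl
x·-0ˢ (suc i) = refl

x·-⊕ : ∀ f g → x· (f ⊕ g) ≗ x· f ⊕ x· g
x·-⊕ f g zero = refl
x·-⊕ f g (suc i) = refl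

x·-interleave : ∀ f g → x· interleave f g ≗ interleave (x· g) f
x·-interleave f g zero = refl
x·-interleave f g (suc i) = refl

interleave-⊕ : ∀ f g f′ g′ → interleave f g ⊕ interleave f′ g′ ≗ interleave (f ⊕ f′) (g ⊕ g′)
interleave-⊕ f g f′ g′ zero = refl
interleave-⊕ f g f′ g′ (suc i) = interleave-⊕ g (f ∘ suc) g′ (f′ ∘ suc) i

[1+x]·-interleave : ∀ f g → [1+x]· interleave f g ≗ interleave (f ⊕ x· g) (g ⊕ f)
[1+x]·-interleave f g = begin
  interleave f g ⊕ x· interleave f g          ≈⟨ ⊕-congˡ (interleave f g) (x·-interleave f g) ⟩
  interleave f g ⊕ interleave (x· g) f        ≈⟨ interleave-⊕ f g (x· g) f ⟩
  interleave (f ⊕ x· g) (g ⊕ f)               ∎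
  where open ≗-Reasoning

[1+x+x²]·-interleave : ∀ f g →
  [1+x+x²]· interleave f g ≗ interleave (f ⊕ x· (g ⊕ f)) (g ⊕ (f ⊕ x· g))
[1+x+x²]·-interleave f g = begin
  interleave f g ⊕ x· [1+x]· interleave f g                ≈⟨ ⊕-congˡ (interleave f g) (x·-cong ([1+x]·-interleave f g)) ⟩
  interleave f g ⊕ x· interleave (f ⊕ x· g) (g ⊕ f)        ≈⟨ ⊕-congˡ (interleave f g) (x·-interleave _ _) ⟩
  interleave f g ⊕ interleave (x· (g ⊕ f)) (f ⊕ x· g)      ≈⟨ interleave-⊕ f g _ _ ⟩
  interleave (f ⊕ x· (g ⊕ f)) (g ⊕ (f ⊕ x· g))             ∎
  where open ≗-Reasoning

x+y+y≡x : ∀ x y → x ℙ.+ y ℙ.+ y ≡ x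
x+y+y≡x 0ℙ y = ℙ.p+p≡0ℙ y
x+y+y≡x 1ℙ y = ℙ.p⁻¹+p≡1ℙ y

x+[x+y]≡y : ∀ x y → x ℙ.+ (x ℙ.+ y) ≡ y
x+[x+y]≡y 0ℙ y = refl
x+[x+y]≡y 1ℙ y = ℙ.⁻¹-involutive y

[1+x+x²]·-spread : ∀ g → [1+x+x²]· spread g ≗ interleave ([1+x]· g) g
[1+x+x²]·-spread g = begin
  [1+x+x²]· interleave g 0ˢ                           ≈⟨ [1+x+x²]·-interleave g 0ˢ ⟩
  interleave (g ⊕ x· (0ˢ ⊕ g)) (0ˢ ⊕ (g ⊕ x· 0ˢ))     ≈⟨ interleave-cong (⊕-congˡ g (x·-cong λ _ → refl)) odd ⟩
  interleave ([1+x]· g) g                             ∎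
  where
    open ≗-Reasoning
    odd : 0ˢ ⊕ (g ⊕ x· 0ˢ) ≗ g
    odd i = trans (cong (g i ℙ.+_) (x·-0ˢ i)) (ℙ.+-identityʳ (g i))

-- In characteristic 2, (1 + x + x²)² = 1 + x² + x⁴.
[1+x+x²]²·-spread : ∀ g → [1+x+x²]· [1+x+x²]· spread g ≗ spread ([1+x+x²]· g)
[1+x+x²]²·-spread g = begin
  [1+x+x²]· [1+x+x²]· spread g                                  ≈⟨ [1+x+x²]·-cong ([1+x+x²]·-spread g) ⟩
  [1+x+x²]· interleave ([1+x]· g) g                             ≈⟨ [1+x+x²]·-interleave ([1+x]· g) g ⟩
  interleave ([1+x]· g ⊕ x· (g ⊕ [1+x]· g)) (g ⊕ ([1+x]· g ⊕ x· g)) ≈⟨ interleave-cong even odd ⟩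
  interleave ([1+x+x²]· g) 0ˢ                                   ∎
  where
    open ≗-Reasoning
    even : [1+x]· g ⊕ x· (g ⊕ [1+x]· g) ≗ [1+x+x²]· g
    even i = trans (cong (([1+x]· g) i ℙ.+_) (x·-cong (λ j → x+[x+y]≡y (g j) ((x· g) j)) i))
               (trans (ℙ.+-assoc (g i) ((x· g) i) ((x· x· g) i)) (cong (g i ℙ.+_) (sym (x·-⊕ g (x· g) i))))
    odd : g ⊕ ([1+x]· g ⊕ x· g) ≗ 0ˢ
    odd i = trans (cong (g i ℙ.+_) (x+y+y≡x (g i) _)) (ℙ.p+p≡0ℙ (g i))

[1+x]·[1+x+x²]·-spread : ∀ g → [1+x]· [1+x+x²]· spread g ≗ interleave g (x· g)
[1+x]·[1+x+x²]·-spread g = begin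
  [1+x]· [1+x+x²]· spread g                     ≈⟨ [1+x]·-cong ([1+x+x²]·-spread g) ⟩
  [1+x]· interleave ([1+x]· g) g                ≈⟨ [1+x]·-interleave ([1+x]· g) g ⟩
  interleave ([1+x]· g ⊕ x· g) (g ⊕ [1+x]· g)   ≈⟨ interleave-cong (λ i → x+y+y≡x (g i) _) (λ i → x+[x+y]≡y (g i) _) ⟩
  interleave g (x· g)                           ∎
  where open ≗-Reasoning

-- Reduction modulo 2

reduce : Poly → Seq₂
reduce p i = parity (coeff p i)

reduce-0∷ : ∀ p → reduce (0 ∷ p) ≗ x· reduce p
reduce-0∷ p zero = refl
reduce-0∷ p (suc i) = refl

reduce-mulP-∷ : ∀ a p q → reduce (mulP (a ∷ p) q) ≗ parity a ·ˢ reduce q ⊕ x· reduce (mulP p q)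
reduce-mulP-∷ a p q i = begin
  parity (coeff (addP (scaleP a q) (0 ∷ mulP p q)) i)                 ≡⟨ cong parity (coeff-addP (scaleP a q) _ i) ⟩
  parity (coeff (scaleP a q) i + coeff (0 ∷ mulP p q) i)              ≡⟨ ℙ.+-homo-+ (coeff (scaleP a q) i) _ ⟩
  parity (coeff (scaleP a q) i) ℙ.+ reduce (0 ∷ mulP p q) i           ≡⟨ cong₂ ℙ._+_ scaled (reduce-0∷ (mulP p q) i) ⟩
  parity a ℙ.* reduce q i ℙ.+ (x· reduce (mulP p q)) i                ∎
  where
    open ≡-Reasoning
    scaled : parity (coeff (scaleP a q) i) ≡ parity a ℙ.* reduce q i
    scaled = trans (cong parity (coeff-scaleP a q i)) (ℙ.*-homo-* a (coeff q i))

reduce-mulP-trinom : ∀ q → reduce (mulP trinom q) ≗ [1+x+x²]· reduce q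
reduce-mulP-trinom q = begin
  reduce (mulP trinom q)                   ≈⟨ reduce-mulP-∷ 1 (1 ∷ 1 ∷ []) q ⟩
  f ⊕ x· reduce (mulP (1 ∷ 1 ∷ []) q)      ≈⟨ ⊕-congˡ f (x·-cong (reduce-mulP-∷ 1 (1 ∷ []) q)) ⟩
  f ⊕ x· (f ⊕ x· reduce (mulP (1 ∷ []) q)) ≈⟨ ⊕-congˡ f (x·-cong (⊕-congˡ f (x·-cong [1]·f≗f))) ⟩
  [1+x+x²]· f                              ∎
  where
    open ≗-Reasoning
    f = reduce q
    [1]·f≗f : reduce (mulP (1 ∷ []) q) ≗ f
    [1]·f≗f i = trans (reduce-mulP-∷ 1 [] q i) (trans (cong (f i ℙ.+_) (x·-0ˢ i)) (ℙ.+-identityʳ (f i)))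

trinom₂^ : ℕ → Seq₂
trinom₂^ n = reduce (powP trinom n)

trinom₂^-suc : ∀ n → trinom₂^ (suc n) ≗ [1+x+x²]· trinom₂^ n
trinom₂^-suc n = reduce-mulP-trinom (powP trinom n)

trinom₂^-double : ∀ n → trinom₂^ (2 * n) ≗ spread (trinom₂^ n)
trinom₂^-double zero zero = refl
trinom₂^-double zero (suc zero) = refl
trinom₂^-double zero (suc (suc i)) = sym (interleave-0ˢ i)
  where
    interleave-0ˢ : interleave 0ˢ 0ˢ ≗ 0ˢ
    interleave-0ˢ zero = refl
    interleave-0ˢ (suc i) = interleave-0ˢ i
trinom₂^-double (suc n) = begin
  trinom₂^ (2 * suc n)                                  ≡⟨ cong trinom₂^ (*-suc 2 n) ⟩
  trinom₂^ (suc (suc (2 * n)))                          ≈⟨ trinom₂^-suc (suc (2 * n)) ⟩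
  [1+x+x²]· trinom₂^ (suc (2 * n))                      ≈⟨ [1+x+x²]·-cong (trinom₂^-suc (2 * n)) ⟩
  [1+x+x²]· [1+x+x²]· trinom₂^ (2 * n)                  ≈⟨ [1+x+x²]·-cong ([1+x+x²]·-cong (trinom₂^-double n)) ⟩
  [1+x+x²]· [1+x+x²]· spread (trinom₂^ n)               ≈⟨ [1+x+x²]²·-spread (trinom₂^ n) ⟩
  spread ([1+x+x²]· trinom₂^ n)                         ≈⟨ interleave-cong (trinom₂^-suc n) (λ _ → refl) ⟨
  spread (trinom₂^ (suc n))                             ∎
  where open ≗-Reasoning

length-powP-trinom : ∀ n → length (powP trinom n) ≤ suc (2 * n)
length-powP-trinom n = length-powP trinom n ≤-refl

trinom₂^-vanishes : ∀ n → trinom₂^ n (suc (2 * n)) ≡ 0ℙ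
trinom₂^-vanishes n = cong parity (coeff-beyond-length (powP trinom n) (length-powP-trinom n))

-- Counting odd coefficients

⟦_⟧ : Parity → ℕ
⟦ 0ℙ ⟧ = 0
⟦ 1ℙ ⟧ = 1

weight : Seq₂ → ℕ → ℕ
weight f zero = 0
weight f (suc n) = ⟦ f 0 ⟧ + weight (f ∘ suc) n

weight-cong : ∀ {f g} → f ≗ g → ∀ n → weight f n ≡ weight g n
weight-cong f≗g zero = refl
weight-cong f≗g (suc n) = cong₂ _+_ (cong ⟦_⟧ (f≗g 0)) (weight-cong (f≗g ∘ suc) n)

weight-0ˢ : ∀ n → weight 0ˢ n ≡ 0
weight-0ˢ zero = refl
weight-0ˢ (suc n) = weight-0ˢ n

weight-suc : ∀ f n → weight f (suc n) ≡ weight f n + ⟦ f n ⟧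
weight-suc f zero = +-identityʳ ⟦ f 0 ⟧
weight-suc f (suc n) = trans (cong (⟦ f 0 ⟧ +_) (weight-suc (f ∘ suc) n)) (sym (+-assoc ⟦ f 0 ⟧ _ _))

weight-x· : ∀ f {n} → f n ≡ 0ℙ → weight (x· f) (suc n) ≡ weight f (suc n)
weight-x· f {n} fn≡0 = begin
  weight f n                ≡⟨ +-identityʳ (weight f n) ⟨
  weight f n + ⟦ 0ℙ ⟧       ≡⟨ cong (λ c → weight f n + ⟦ c ⟧) fn≡0 ⟨
  weight f n + ⟦ f n ⟧      ≡⟨ weight-suc f n ⟨
  weight f (suc n)          ∎
  where open ≡-Reasoning

weight-interleave : ∀ f g n → weight (interleave f g) (2 * n) ≡ weight f n + weight g n
weight-interleave f g zero = refl
weight-interleave f g (suc n) = begin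
  weight (interleave f g) (2 * suc n)                              ≡⟨ cong (weight (interleave f g)) (*-suc 2 n) ⟩
  ⟦ f 0 ⟧ + (⟦ g 0 ⟧ + weight (interleave (f ∘ suc) (g ∘ suc)) (2 * n))
    ≡⟨ cong (λ w → ⟦ f 0 ⟧ + (⟦ g 0 ⟧ + w)) (weight-interleave (f ∘ suc) (g ∘ suc) n) ⟩
  ⟦ f 0 ⟧ + (⟦ g 0 ⟧ + (weight (f ∘ suc) n + weight (g ∘ suc) n))  ≡⟨ +-assoc ⟦ f 0 ⟧ ⟦ g 0 ⟧ _ ⟨
  ⟦ f 0 ⟧ + ⟦ g 0 ⟧ + (weight (f ∘ suc) n + weight (g ∘ suc) n)    ≡⟨ interchange ⟦ f 0 ⟧ ⟦ g 0 ⟧ _ _ ⟩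
  weight f (suc n) + weight g (suc n)                              ∎
  where open ≡-Reasoning

%2≡⟦parity⟧ : ∀ n → n % 2 ≡ ⟦ parity n ⟧
%2≡⟦parity⟧ zero = refl
%2≡⟦parity⟧ (suc zero) = refl
%2≡⟦parity⟧ (suc (suc n)) = %2≡⟦parity⟧ n

sum%2≡weight : ∀ p {N} → length p ≤ N → sum (map (_% 2) p) ≡ weight (reduce p) N
sum%2≡weight [] {N} _ = sym (weight-0ˢ N)
sum%2≡weight (a ∷ p) (s≤s lp) = cong₂ _+_ (%2≡⟦parity⟧ a) (sum%2≡weight p lp)

-- The recurrence for b₁

P : ℕ → Seq₂
P k = trinom₂^ (2 ^ k ∸ 1)

2^[1+k]≡2+2*[2^k∸1] : ∀ k → 2 ^ suc k ≡ suc (suc (2 * (2 ^ k ∸ 1)))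
2^[1+k]≡2+2*[2^k∸1] k = double (m^n>0 2 k)
  where
    double : ∀ {n} → 0 < n → 2 * n ≡ suc (suc (2 * (n ∸ 1)))
    double {suc n} _ = *-suc 2 n

P-suc : ∀ k → P (suc k) ≗ [1+x+x²]· spread (P k)
P-suc k = begin
  trinom₂^ (2 ^ suc k ∸ 1)                ≡⟨ cong (λ m → trinom₂^ (m ∸ 1)) (2^[1+k]≡2+2*[2^k∸1] k) ⟩
  trinom₂^ (suc (2 * (2 ^ k ∸ 1)))        ≈⟨ trinom₂^-suc (2 * (2 ^ k ∸ 1)) ⟩
  [1+x+x²]· trinom₂^ (2 * (2 ^ k ∸ 1))    ≈⟨ [1+x+x²]·-cong (trinom₂^-double (2 ^ k ∸ 1)) ⟩
  [1+x+x²]· spread (P k)                  ∎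
  where open ≗-Reasoning

b₁≡weight : ∀ k → b₁ k ≡ weight (P k) (2 ^ suc k)
b₁≡weight k = sum%2≡weight (powP trinom e) (begin
  length (powP trinom e) ≤⟨ length-powP-trinom e ⟩
  suc (2 * e)            <⟨ n<1+n _ ⟩
  suc (suc (2 * e))      ≡⟨ 2^[1+k]≡2+2*[2^k∸1] k ⟨
  2 ^ suc k              ∎)
  where
    open ≤-Reasoning
    e = 2 ^ k ∸ 1

d₁ : ℕ → ℕ
d₁ k = weight ([1+x]· P k) (2 ^ suc k)

b₁-suc : ∀ k → b₁ (suc k) ≡ d₁ k + b₁ k
b₁-suc k = begin
  b₁ (suc k)                                             ≡⟨ b₁≡weight (suc k) ⟩
  weight (P (suc k)) (2 * 2 ^ suc k)                     ≡⟨ weight-cong (λ i → trans (P-suc k i) ([1+x+x²]·-spread (P k) i)) (2 * 2 ^ suc k) ⟩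
  weight (interleave ([1+x]· P k) (P k)) (2 * 2 ^ suc k) ≡⟨ weight-interleave ([1+x]· P k) (P k) (2 ^ suc k) ⟩
  d₁ k + weight (P k) (2 ^ suc k)                        ≡⟨ cong (d₁ k +_) (b₁≡weight k) ⟨
  d₁ k + b₁ k                                            ∎
  where open ≡-Reasoning

d₁-suc : ∀ k → d₁ (suc k) ≡ b₁ k + b₁ k
d₁-suc k = begin
  weight ([1+x]· P (suc k)) (2 * 2 ^ suc k)                       ≡⟨ weight-cong [1+x]·P[1+k]≗ (2 * 2 ^ suc k) ⟩
  weight (interleave (P k) (x· P k)) (2 * 2 ^ suc k)              ≡⟨ weight-interleave (P k) (x· P k) (2 ^ suc k) ⟩
  weight (P k) (2 ^ suc k) + weight (x· P k) (2 ^ suc k)          ≡⟨ cong (weight (P k) (2 ^ suc k) +_) weight-x·P ⟩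
  weight (P k) (2 ^ suc k) + weight (P k) (2 ^ suc k)             ≡⟨ cong₂ _+_ (b₁≡weight k) (b₁≡weight k) ⟨
  b₁ k + b₁ k                                                     ∎
  where
    open ≡-Reasoning
    [1+x]·P[1+k]≗ : [1+x]· P (suc k) ≗ interleave (P k) (x· P k)
    [1+x]·P[1+k]≗ i = trans ([1+x]·-cong (P-suc k) i) ([1+x]·[1+x+x²]·-spread (P k) i)
    -- P k vanishes at 2^(k+1) − 1, just beyond the degree 2^(k+1) − 2.
    weight-x·P : weight (x· P k) (2 ^ suc k) ≡ weight (P k) (2 ^ suc k)
    weight-x·P rewrite 2^[1+k]≡2+2*[2^k∸1] k = weight-x· (P k) (trinom₂^-vanishes (2 ^ k ∸ 1))

b₁-recurrence : ∀ k → b₁ (suc (suc k)) ≡ b₁ k + b₁ k + b₁ (suc k)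
b₁-recurrence k = trans (b₁-suc (suc k)) (cong (_+ b₁ (suc k)) (d₁-suc k))

-- Formal power series over ℤ

convAux-congʳ : ∀ (f : Series) {g h} → g ≗ h → ∀ n i → convAux f g n i ≡ convAux f h n i
convAux-congʳ f g≗h n zero = cong (f 0 ℤ.*_) (g≗h n)
convAux-congʳ f g≗h n (suc i) =
  cong₂ ℤ._+_ (cong (f (suc i) ℤ.*_) (g≗h (n ∸ suc i))) (convAux-congʳ f g≗h n i)

⋆-congʳ : ∀ (f : Series) {g h} → g ≗ h → f ⋆ g ≗ f ⋆ h
⋆-congʳ f g≗h n = convAux-congʳ f g≗h n n

fromList-beyond-length : ∀ cs {j} → length cs ≤ j → fromList cs j ≡ ℤ.0ℤ
fromList-beyond-length [] _ = refl
fromList-beyond-length (c ∷ cs) (s≤s le) = fromList-beyond-length cs le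

*fromList-beyond-length : ∀ (f : Series) cs {n} j → length cs + j ≤ n → f j ℤ.* fromList cs (n ∸ j) ≡ ℤ.0ℤ
*fromList-beyond-length f cs j le =
  trans (cong (f j ℤ.*_) (fromList-beyond-length cs (m+n≤o⇒m≤o∸n (length cs) le))) (ℤ.*-zeroʳ (f j))

convAux-fromList-vanishes : ∀ (f : Series) cs {n} i → length cs + i ≤ n → convAux f (fromList cs) n i ≡ ℤ.0ℤ
convAux-fromList-vanishes f cs zero le = *fromList-beyond-length f cs 0 le
convAux-fromList-vanishes f cs (suc i) le = cong₂ ℤ._+_
  (*fromList-beyond-length f cs (suc i) le)
  (convAux-fromList-vanishes f cs i (≤-trans (+-monoʳ-≤ (length cs) (n≤1+n i)) le))

⋆-fromList₃ : ∀ (f : Series) a b c n → (f ⋆ fromList (a ∷ b ∷ c ∷ [])) (2 + n) ≡ f (2 + n) ℤ.* a ℤ.+ (f (1 + n) ℤ.* b ℤ.+ f n ℤ.* c)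
⋆-fromList₃ f a b c zero = refl
⋆-fromList₃ f a b c (suc m)
  rewrite n∸n≡0 m | m+n∸n≡m 1 m | m+n∸n≡m 2 m | convAux-fromList-vanishes f (a ∷ b ∷ c ∷ []) m ≤-refl =
  cong (λ t → f (3 + m) ℤ.* a ℤ.+ (f (2 + m) ℤ.* b ℤ.+ t)) (ℤ.+-identityʳ (f (1 + m) ℤ.* c))

fromList₂-⋆ : ∀ a b (g : Series) n → (fromList (a ∷ b ∷ []) ⋆ g) (suc n) ≡ b ℤ.* g n ℤ.+ a ℤ.* g (suc n)
fromList₂-⋆ a b g n = high-terms-vanish n
  where
    high-terms-vanish : ∀ i → convAux (fromList (a ∷ b ∷ [])) g (suc n) (suc i) ≡ convAux (fromList (a ∷ b ∷ [])) g (suc n) 1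
    high-terms-vanish zero = refl
    high-terms-vanish (suc i) = trans (ℤ.+-identityˡ _) (high-terms-vanish i)

[1+t]⋆[1-2t] : onePlusT ⋆ oneMinus2T ≗ fromList (ℤ.1ℤ ∷ ℤ.-1ℤ ∷ -[1+ 1 ] ∷ [])
[1+t]⋆[1-2t] zero = refl
[1+t]⋆[1-2t] (suc n) = trans (fromList₂-⋆ ℤ.1ℤ ℤ.1ℤ oneMinus2T n) (coefficients n)
  where
    coefficients : ∀ n → ℤ.1ℤ ℤ.* oneMinus2T n ℤ.+ ℤ.1ℤ ℤ.* oneMinus2T (suc n) ≡ fromList (ℤ.1ℤ ∷ ℤ.-1ℤ ∷ -[1+ 1 ] ∷ []) (suc n)
    coefficients zero = refl
    coefficients (suc zero) = refl
    coefficients (suc (suc n)) = refl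

f₁-recurrence : ∀ k → f₁ (suc (suc k)) ≡ f₁ k ℤ.+ f₁ k ℤ.+ f₁ (suc k)
f₁-recurrence k = begin
  ℤ.+ b₁ (suc (suc k))                        ≡⟨ cong ℤ.+_ (b₁-recurrence k) ⟩
  ℤ.+ (b₁ k + b₁ k + b₁ (suc k))              ≡⟨ ℤ.pos-+ (b₁ k + b₁ k) (b₁ (suc k)) ⟩
  ℤ.+ (b₁ k + b₁ k) ℤ.+ f₁ (suc k)            ≡⟨ cong (ℤ._+ f₁ (suc k)) (ℤ.pos-+ (b₁ k) (b₁ k)) ⟩
  f₁ k ℤ.+ f₁ k ℤ.+ f₁ (suc k)                ∎
  where open ≡-Reasoning

recurrence⇒[1-t-2t²]-annihilates : ∀ {x} (y z : ℤ.ℤ) → x ≡ z ℤ.+ z ℤ.+ y →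
  x ℤ.* ℤ.1ℤ ℤ.+ (y ℤ.* ℤ.-1ℤ ℤ.+ z ℤ.* -[1+ 1 ]) ≡ ℤ.0ℤ
recurrence⇒[1-t-2t²]-annihilates y z refl = ring-identity y z
  where
    ring-identity : ∀ y z → (z ℤ.+ z ℤ.+ y) ℤ.* ℤ.1ℤ ℤ.+ (y ℤ.* ℤ.-1ℤ ℤ.+ z ℤ.* -[1+ 1 ]) ≡ ℤ.0ℤ
    ring-identity = solve-∀

mainTheorem1 : (n : ℕ) → (f₁ ⋆ (onePlusT ⋆ oneMinus2T)) n ≡ onePlus2T n
mainTheorem1 zero = refl
mainTheorem1 (suc zero) = refl
mainTheorem1 (suc (suc n)) = begin
  (f₁ ⋆ (onePlusT ⋆ oneMinus2T)) (2 + n)                                ≡⟨ ⋆-congʳ f₁ [1+t]⋆[1-2t] (2 + n) ⟩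
  (f₁ ⋆ fromList (ℤ.1ℤ ∷ ℤ.-1ℤ ∷ -[1+ 1 ] ∷ [])) (2 + n)                 ≡⟨ ⋆-fromList₃ f₁ ℤ.1ℤ ℤ.-1ℤ -[1+ 1 ] n ⟩
  f₁ (2 + n) ℤ.* ℤ.1ℤ ℤ.+ (f₁ (1 + n) ℤ.* ℤ.-1ℤ ℤ.+ f₁ n ℤ.* -[1+ 1 ])  ≡⟨ recurrence⇒[1-t-2t²]-annihilates (f₁ (1 + n)) (f₁ n) (f₁-recurrence n) ⟩
  ℤ.0ℤ                                                                   ∎
  where open ≡-Reasoning
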